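{- Let $\pi\in S_n$ and let $f=(\tau_1,\ldots,\tau_r)$ be an ordered list of star transpositions satisfying the following two conditions relative to $\pi$. (C1) For every cycle $\sigma$ of $\pi$: if $\sigma$ does not contain $1$, then it can be written $\sigma=(a_1\,a_2\,\ldots\,a_\ell)$ so that $(1\,a_1)$ appears exactly twice in $f$, each $(1\,a_i)$ with $i\ne1$ appears exactly once in $f$, and the factors of $f$ meeting $\sigma$, read from right to left, are $(1\,a_1),(1\,a_2),\ldots,(1\,a_\ell),(1\,a_1)$; if $\sigma=(1\,b_2\,\cdots\,b_\ell)$ contains $1$, then each $(1\,b_i)$ appears exactly once in $f$ and the factors of $f$ meeting $\sigma$, read from right to left, are $(1\,b_2),(1\,b_3),\ldots,(1\,b_\ell)$. (C2) Whenever $\sigma,\hat\sigma$ are distinct cycles of $\pi$ and $a<c<b$ are indices such that $\tau_a,\tau_b$ meet $\sigma$ and $\tau_c$ meets $\hat\sigma$, the cycle $\hat\sigma$ does not contain $1$ and every $j$ with $\tau_j$ meeting $\hat\sigma$ satisfies $a<j<b$. Then $\tau_1\cdots\tau_r=\pi$ and $f$ is a minimal transitive star factorization of $\pi$. Consequently, conditions (C1) and (C2) characterize the minimal transitive star factorizations of $\pi$.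
   Context: A star transposition in $S_n$ is a transposition $(1\,i)$ with $2\le i\le n$. Permutations are multiplied as functions, $\rho\sigma(j)=\rho(\sigma(j))$. A star factorization of $\pi\in S_n$ of length $r$ is an ordered list $(\tau_1,\ldots,\tau_r)$ of star transpositions with $\tau_1\cdots\tau_r=\pi$; it is transitive if the group generated by its factors acts transitively on $\{1,\ldots,n\}$. If $\pi$ has $m$ cycles (counting fixed points), a minimal transitive star factorization of $\pi$ is a transitive star factorization of length $n+m-2$. A star transposition $(1\,i)$ meets the cycle $\sigma$ of $\pi$ if $\sigma$ contains the symbol $i$. "Read from right to left" means listed in order of decreasing position index in $f$. (It is known that every minimal transitive star factorization of $\pi$ satisfies (C1) and (C2).) -}

module Defs where

open import Data.Nat using (ℕ; suc; _+_)
open import Data.Fin using (Fin; zero; suc; _≟_; _<_)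
open import Data.Fin.Permutation using (Permutation′; _⟨$⟩ʳ_)
open import Data.Fin.Permutation.Components using (transpose)
open import Data.List using (List; []; _∷_; _++_; [_]; length; filter; reverse; lookup)
open import Data.List.Membership.Propositional using (_∈_; _∉_)
open import Data.List.Relation.Binary.Subset.Propositional using (_⊆_)
open import Data.List.Relation.Unary.All using (All)
open import Data.List.Relation.Unary.AllPairs using (AllPairs)
open import Data.List.Relation.Unary.Unique.Propositional using (Unique)
open import Data.List.Relation.Unary.Linked using (Linked)
open import Data.Empty using (⊥)
open import Data.Product using (_×_; ∃-syntax)
open import Relation.Nullary using (¬_)
open import Relation.Binary.PropositionalEquality using (_≡_; _≢_)
import Data.List.Membership.DecPropositional as DecMem

-- Symbols of S_n with n = suc k are Fin (suc k); the symbol 1 is `zero`.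
-- A star transposition (1 i) is represented by its symbol i : Fin (suc k), i ≢ zero.

module _ {k : ℕ} where
  open DecMem (_≟_ {suc k}) public using (_∈?_)

IsCycle : ∀ {k} → Permutation′ (suc k) → List (Fin (suc k)) → Set
IsCycle π [] = ⊥
IsCycle π (a ∷ as) =
  Unique (a ∷ as) × Linked (λ x y → π ⟨$⟩ʳ x ≡ y) ((a ∷ as) ++ [ a ])

-- two cycle notations denote the same cycle iff they have the same underlying set
SameCycle : ∀ {k} → List (Fin (suc k)) → List (Fin (suc k)) → Set
SameCycle σ σ' = σ ⊆ σ' × σ' ⊆ σ

IsStarList : ∀ {k} → List (Fin (suc k)) → Set
IsStarList f = All (λ t → t ≢ zero) f

star : ∀ {k} → Fin (suc k) → Fin (suc k) → Fin (suc k)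
star i = transpose zero i

-- product τ₁ ⋯ τ_r as functions (τ_r applied first)
prod : ∀ {k} → List (Fin (suc k)) → Fin (suc k) → Fin (suc k)
prod [] x = x
prod (t ∷ ts) x = star t (prod ts x)

count : ∀ {k} → Fin (suc k) → List (Fin (suc k)) → ℕ
count a f = length (filter (λ t → t ≟ a) f)

meetingRL : ∀ {k} → List (Fin (suc k)) → List (Fin (suc k)) → List (Fin (suc k))
meetingRL σ f = filter (λ t → t ∈? σ) (reverse f)

-- The group generated by the factors of f acts transitively:
-- every element of that group is a product of factors of f
-- (the factors are involutions), so transitivity says any x can be sent to any y.
IsTransitive : ∀ {k} → List (Fin (suc k)) → Set
IsTransitive {k} f = ∀ (x y : Fin (suc k)) → ∃[ ws ] (ws ⊆ f × prod ws x ≡ y)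

-- π has exactly m cycles (counting fixed points): there is a list of m
-- pairwise distinct cycles of π covering all symbols.
NumCycles : ∀ {k} → Permutation′ (suc k) → ℕ → Set
NumCycles {k} π m =
  ∃[ cs ] ( All (IsCycle π) cs
          × AllPairs (λ σ σ' → ¬ SameCycle σ σ') cs
          × (∀ (x : Fin (suc k)) → ∃[ σ ] (σ ∈ cs × x ∈ σ))
          × length cs ≡ m )

C1 : ∀ {k} → Permutation′ (suc k) → List (Fin (suc k)) → Set
C1 {k} π f =
  ∀ (σ : List (Fin (suc k))) → IsCycle π σ →
    ( zero ∉ σ →
      ∃[ a₁ ] ∃[ as ] ( IsCycle π (a₁ ∷ as) × SameCycle (a₁ ∷ as) σ
                      × count a₁ f ≡ 2
                      × All (λ a → count a f ≡ 1) as
                      × meetingRL σ f ≡ (a₁ ∷ as) ++ [ a₁ ] ) )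
    × ( zero ∈ σ →
      ∃[ bs ] ( IsCycle π (zero ∷ bs) × SameCycle (zero ∷ bs) σ
              × All (λ b → count b f ≡ 1) bs
              × meetingRL σ f ≡ bs ) )

-- Condition (C2); positions in f are Fin (length f) (0-based)
C2 : ∀ {k} → Permutation′ (suc k) → List (Fin (suc k)) → Set
C2 {k} π f =
  ∀ (σ σ̂ : List (Fin (suc k))) → IsCycle π σ → IsCycle π σ̂ → ¬ SameCycle σ σ̂ →
  ∀ (a c b : Fin (length f)) → a < c → c < b →
    lookup f a ∈ σ → lookup f b ∈ σ → lookup f c ∈ σ̂ →
    zero ∉ σ̂ × (∀ (j : Fin (length f)) → lookup f j ∈ σ̂ → a < j × j < b)

IsMinTransStarFact : ∀ {k} → Permutation′ (suc k) → List (Fin (suc k)) → Set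
IsMinTransStarFact {k} π f =
  IsStarList f
  × (∀ x → prod f x ≡ π ⟨$⟩ʳ x)
  × IsTransitive f
  × ∃[ m ] (NumCycles π m × length f + 2 ≡ suc k + m)

{-# OPTIONS --safe #-}
module Submission where

-- A symbol x ≠ 1 is fixed by the factors after the last (1 x) of f, which sends it to 1; so
-- τ₁⋯τ_r(x) is the image of 1 under the prefix P of f before that factor. Read P from right to
-- left: its last factor (1 y) sends 1 to y. If y lies in the cycle σ of x, then by (C1) y is the
-- successor of x and occurs nowhere else in P. Otherwise, by (C2), the cycle σ̂ of y avoids 1 and all
-- its factors lie in P, and by (C1) they read (1 a₁), …, (1 a₁) with y = a₁; so y is sent back to 1
-- by the leftmost factor of σ̂ and the walk goes on to its left. The image of 1 is the same walk
-- through all of f. Transitivity holds because every symbol ≠ 1 occurs in f, and by (C1) a cycle of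
-- length ℓ meets ℓ + 1 factors if it avoids 1 and ℓ − 1 otherwise, which sums to n + m − 2.

open import Defs
open import Algebra.Properties.CommutativeSemigroup using (x∙yz≈y∙xz)
open import Data.Empty using (⊥)
open import Data.Fin as F using (Fin; toℕ; fromℕ; fromℕ<; _≟_)
open import Data.Fin.Properties
  using (toℕ-injective; toℕ<n; toℕ-fromℕ; toℕ-fromℕ<; toℕ-inject; pigeonhole; ¬∀⟶∃¬-smallest)
open import Data.Fin.Permutation using (Permutation′; _⟨$⟩ʳ_; _⟨$⟩ˡ_; inverseˡ)
open import Data.List
  using (List; []; _∷_; _++_; [_]; _∷ʳ_; length; filter; reverse; lookup; take; head; map; applyUpTo; allFin)
open import Data.List.Properties
  using (∷-injective; ∷ʳ-injective; ++-assoc; ++-identityʳ; length-++; length-reverse; length-tabulate;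
         reverse-++; filter-++; filter-accept; filter-reject; filter-all; filter-none; take-suc; take-all;
         applyUpTo-∷ʳ; map-cong-local)
open import Data.List.Membership.Propositional using (_∈_; _∉_; find; lose)
open import Data.List.Membership.Propositional.Properties
  using (∈-++⁺ˡ; ∈-++⁻; ∈-filter⁺; ∈-filter⁻; ∈-allFin; ∈-lookup)
open import Data.List.Membership.Propositional.Properties.WithK using (unique∧set⇒bag)
open import Data.List.Relation.Binary.BagAndSetEquality using (∼bag⇒↭)
open import Data.List.Relation.Binary.Disjoint.Propositional using (Disjoint)
open import Data.List.Relation.Binary.Permutation.Propositional.Properties using (↭-length)
open import Data.List.Relation.Binary.Subset.Propositional using (_⊆_)
open import Data.List.Relation.Unary.All as All using (All; []; _∷_)
open import Data.List.Relation.Unary.AllPairs as AllPairs using (AllPairs; []; _∷_)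
open import Data.List.Relation.Unary.Any using (Any; here; there; any?)
open import Data.List.Relation.Unary.Any.Properties using (reverse⁺; reverse⁻)
open import Data.List.Relation.Unary.Linked using (Linked; [-]; _∷_)
import Data.List.Relation.Unary.Linked.Properties as Linked
open import Data.List.Relation.Unary.Unique.Propositional using (Unique)
import Data.List.Relation.Unary.Unique.Propositional.Properties as Unique
open import Data.Maybe using (fromMaybe)
open import Data.Nat using (ℕ; zero; suc; _+_; _≤_; _<_; z≤n; s≤s; _≤?_; _<?_)
open import Data.Nat.Induction using (<-rec)
open import Data.Nat.ListAction using (sum)
open import Data.Nat.Properties
  using (≤-refl; ≤-trans; ≤-reflexive; <-trans; ≤-<-trans; <-≤-trans; <⇒≤; <⇒≱; ≤⇒≯; ≰⇒>; ≮⇒≥; <-irrefl;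
         ≤∧≢⇒<; ≤-pred; n<1+n; n≤1+n; m<n+m; m≤n⇒∃[o]m+o≡n; m≤n⇒m<n∨m≡n; +-suc; +-assoc; +-comm;
         +-identityʳ; +-commutativeSemigroup)
import Data.Product as Product
open import Data.Product using (_×_; _,_; proj₁; proj₂; ∃; ∃₂; ∃-syntax)
import Data.Sum as Sum
open import Data.Sum using (_⊎_; inj₁; inj₂; [_,_]′)
open import Function using (_∘_)
open import Function.Bundles using (mk⇔)
open import Relation.Binary.Definitions using (DecidableEquality)
open import Relation.Binary.PropositionalEquality
  using (_≡_; _≢_; refl; sym; trans; cong; cong₂; subst; module ≡-Reasoning)
open import Relation.Nullary using (¬_; Dec; yes; no; contradiction; ¬?)
open import Relation.Nullary.Decidable using (decidable-stable)
open import Relation.Unary using (Decidable)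

module _ {A : Set} where

  ∈-∃++-last : DecidableEquality A → ∀ {x : A} {xs} → x ∈ xs → ∃₂ λ P S → xs ≡ P ++ x ∷ S × x ∉ S
  ∈-∃++-last _≟_ {x} {y ∷ ys} x∈ with any? (x ≟_) ys
  ... | yes x∈ys with P , S , ys≡ , x∉S ← ∈-∃++-last _≟_ x∈ys = y ∷ P , S , cong (y ∷_) ys≡ , x∉S
  ... | no x∉ys with x∈
  ...   | here refl  = [] , ys , refl , x∉ys
  ...   | there x∈ys = contradiction x∈ys x∉ys

  Unique-++⁻ʳ : ∀ (X : List A) {Y} → Unique (X ++ Y) → Unique Y
  Unique-++⁻ʳ []      u       = u
  Unique-++⁻ʳ (_ ∷ X) (_ ∷ u) = Unique-++⁻ʳ X u

  Unique-suffix : ∀ (X : List A) {x Y} → Unique (X ++ x ∷ Y) → Unique Y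
  Unique-suffix X u with Unique-++⁻ʳ X u
  ... | _ ∷ u′ = u′

  Unique-after-head : ∀ {a : A} {L} X {x Y} → Unique L → a ∷ L ≡ X ++ x ∷ Y → Unique Y
  Unique-after-head []      L-unique refl = L-unique
  Unique-after-head (_ ∷ X) L-unique refl = Unique-suffix X L-unique

  Unique-∷ʳ-rotate : ∀ {a : A} {as} → Unique (a ∷ as) → Unique (as ∷ʳ a)
  Unique-∷ʳ-rotate (a∉as ∷ as-unique) =
    Unique.++⁺ as-unique ([] ∷ []) λ { (a∈as , here refl) → All.lookup a∉as a∈as refl }

  unique∧⊆∧⊇⇒length≡ : ∀ {xs ys : List A} → Unique xs → Unique ys → xs ⊆ ys → ys ⊆ xs →
                       length xs ≡ length ys
  unique∧⊆∧⊇⇒length≡ u v xs⊆ys ys⊆xs = ↭-length (∼bag⇒↭ (unique∧set⇒bag u v (mk⇔ xs⊆ys ys⊆xs)))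

  module _ {R : A → A → Set} where

    Linked-adjacent : ∀ (X : List A) {x y} Y → Linked R (X ++ x ∷ y ∷ Y) → R x y
    Linked-adjacent []          Y (r ∷ _) = r
    Linked-adjacent (_ ∷ [])    Y (_ ∷ l) = Linked-adjacent [] Y l
    Linked-adjacent (_ ∷ _ ∷ X) Y (_ ∷ l) = Linked-adjacent (_ ∷ X) Y l

    Linked-next : ∀ (X : List A) {x} Y {z} → Linked R (X ++ x ∷ Y ++ [ z ]) → R x (fromMaybe z (head Y))
    Linked-next X []      = Linked-adjacent X []
    Linked-next X (_ ∷ Y) = Linked-adjacent X (Y ++ _)

    Linked-cycle-next : ∀ {a as} → Unique (a ∷ as) → Linked R ((a ∷ as) ++ [ a ]) →
                        ∀ X {x} Y {z} → (a ∷ as) ++ [ a ] ≡ X ++ x ∷ Y → x ∉ X →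
                        R x (fromMaybe z (head Y)) × Unique Y × Y ≢ []
    Linked-cycle-next {as = as} _ _ X [] eq x∉X with refl , refl ← ∷ʳ-injective (_ ∷ as) X eq =
      contradiction (here refl) x∉X
    Linked-cycle-next unique linked X (_ ∷ Y) eq _ =
      Linked-adjacent X Y (subst (Linked R) eq linked) , Unique-after-head X (Unique-∷ʳ-rotate unique) eq , λ ()

  lookup∈take : ∀ (xs : List A) i {q} → toℕ i < q → lookup xs i ∈ take q xs
  lookup∈take (_ ∷ _)  F.zero    {suc _} _         = here refl
  lookup∈take (_ ∷ xs) (F.suc i) {suc _} (s≤s i<q) = there (lookup∈take xs i i<q)

  ∈-take⇒lookup : ∀ (xs : List A) q {y} → y ∈ take q xs → ∃[ i ] (toℕ i < q × lookup xs i ≡ y)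
  ∈-take⇒lookup (_ ∷ _)  (suc _) (here refl) = F.zero , s≤s z≤n , refl
  ∈-take⇒lookup (_ ∷ xs) (suc q) (there y∈) with i , i<q , eq ← ∈-take⇒lookup xs q y∈ =
    F.suc i , s≤s i<q , eq

  lookup-take-split : ∀ (xs : List A) q U {u} V → take q xs ≡ U ++ u ∷ V →
                      ∃[ i ] (toℕ i ≡ length U × toℕ i < q × lookup xs i ≡ u)
  lookup-take-split (_ ∷ _)  (suc _) []      _ eq = F.zero , refl , s≤s z≤n , proj₁ (∷-injective eq)
  lookup-take-split (_ ∷ xs) (suc q) (_ ∷ U) V eq
    with i , i≡ , i<q , xs[i]≡ ← lookup-take-split xs q U V (proj₂ (∷-injective eq)) =
    F.suc i , cong suc i≡ , s≤s i<q , xs[i]≡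

  take-length-prefix : ∀ (xs : List A) q U {W} → take q xs ≡ U ++ W → take (length U) xs ≡ U
  take-length-prefix _        _       []      _  = refl
  take-length-prefix (_ ∷ xs) (suc q) (_ ∷ U) eq with refl , eq′ ← ∷-injective eq =
    cong (_ ∷_) (take-length-prefix xs q U eq′)

  take-suc′ : ∀ (xs : List A) {q} (q< : q < length xs) → take (suc q) xs ≡ take q xs ∷ʳ lookup xs (fromℕ< q<)
  take-suc′ (_ ∷ _)  {zero}  _        = refl
  take-suc′ (x ∷ xs) {suc q} (s≤s q<) = cong (x ∷_) (take-suc′ xs q<)

  length-filter≡1 : ∀ {P : A → Set} (P? : Decidable P) {xs} →
                    AllPairs (λ a b → ¬ (P a × P b)) xs → Any P xs → length (filter P? xs) ≡ 1
  length-filter≡1 P? (excl ∷ _) (here pa) =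
    cong length (trans (filter-accept P? pa)
                       (cong (_ ∷_) (filter-none P? (All.map (λ ¬both pb → ¬both (pa , pb)) excl))))
  length-filter≡1 P? (excl ∷ excls) (there any) with _ , b∈ , pb ← find any =
    trans (cong length (filter-reject P? λ pa → All.lookup excl b∈ (pa , pb))) (length-filter≡1 P? excls any)

module _ {A B : Set} {R : A → B → Set} (R? : ∀ a b → Dec (R a b)) where

  private
    related : List A → B → ℕ
    related xs b = length (filter (λ x → R? x b) xs)

    +-exchange : ∀ l m n {s} → s ≡ m + n → l + s ≡ m + (l + n)
    +-exchange l m n refl = x∙yz≈y∙xz +-commutativeSemigroup l m n

  sum-length-filter-∷ : ∀ a xs (bs : List B) →
    sum (map (λ b → length (filter (λ x → R? x b) (a ∷ xs))) bs) ≡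
    length (filter (R? a) bs) + sum (map (λ b → length (filter (λ x → R? x b) xs)) bs)
  sum-length-filter-∷ a xs []       = refl
  sum-length-filter-∷ a xs (b ∷ bs) with R? a b
  ... | yes _ = cong suc (+-exchange (related xs b) _ (sum (map (related xs) bs)) (sum-length-filter-∷ a xs bs))
  ... | no  _ = +-exchange (related xs b) _ (sum (map (related xs) bs)) (sum-length-filter-∷ a xs bs)

  double-counting : ∀ xs (bs : List B) → (∀ {a} → a ∈ xs → length (filter (R? a) bs) ≡ 1) →
                    sum (map (λ b → length (filter (λ a → R? a b) xs)) bs) ≡ length xs
  double-counting []       []       _   = refl
  double-counting []       (_ ∷ bs) _   = double-counting [] bs λ ()
  double-counting (a ∷ xs) bs       one =
    trans (sum-length-filter-∷ a xs bs) (cong₂ _+_ (one (here refl)) (double-counting xs bs (one ∘ there)))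

sum-map-suc : ∀ {A : Set} (g : A → ℕ) xs → sum (map (λ x → suc (g x)) xs) ≡ sum (map g xs) + length xs
sum-map-suc g []       = refl
sum-map-suc g (x ∷ xs) = begin
  suc (g x + sum (map (λ x → suc (g x)) xs)) ≡⟨ cong (λ n → suc (g x + n)) (sum-map-suc g xs) ⟩
  suc (g x + (sum (map g xs) + length xs))   ≡⟨ cong suc (+-assoc (g x) _ _) ⟨
  suc (g x + sum (map g xs) + length xs)     ≡⟨ +-suc _ (length xs) ⟨
  g x + sum (map g xs) + suc (length xs)     ∎
  where open ≡-Reasoning

module _ {k : ℕ} where

  star-self : ∀ (t : Fin (suc k)) → star t t ≡ F.zero
  star-self t with t ≟ F.zero
  ... | yes refl = refl
  ... | no _ with t ≟ t
  ...   | yes _  = refl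
  ...   | no t≢t = contradiction refl t≢t

  star-fix : ∀ {t y : Fin (suc k)} → y ≢ F.zero → y ≢ t → star t y ≡ y
  star-fix {t} {y} y≢0 y≢t with y ≟ F.zero
  ... | yes y≡0 = contradiction y≡0 y≢0
  ... | no _ with y ≟ t
  ...   | yes y≡t = contradiction y≡t y≢t
  ...   | no _    = refl

  prod-++ : ∀ (xs ys : List (Fin (suc k))) y → prod (xs ++ ys) y ≡ prod xs (prod ys y)
  prod-++ []       ys y = refl
  prod-++ (x ∷ xs) ys y = cong (star x) (prod-++ xs ys y)

  prod-fix : ∀ {xs : List (Fin (suc k))} {y} → y ≢ F.zero → y ∉ xs → prod xs y ≡ y
  prod-fix {[]}     _   _  = refl
  prod-fix {x ∷ xs} y≢0 y∉ = trans (cong (star x) (prod-fix y≢0 (y∉ ∘ there))) (star-fix y≢0 (y∉ ∘ here))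

  prod-last-occurrence : ∀ P {y : Fin (suc k)} Q → y ≢ F.zero → y ∉ Q → prod (P ++ y ∷ Q) y ≡ prod P F.zero
  prod-last-occurrence P {y} Q y≢0 y∉Q = begin
    prod (P ++ y ∷ Q) y        ≡⟨ prod-++ P (y ∷ Q) y ⟩
    prod P (star y (prod Q y)) ≡⟨ cong (prod P ∘ star y) (prod-fix y≢0 y∉Q) ⟩
    prod P (star y y)          ≡⟨ cong (prod P) (star-self y) ⟩
    prod P F.zero              ∎
    where open ≡-Reasoning

  module _ (σ : List (Fin (suc k))) where

    meetingRL-++ : ∀ xs ys → meetingRL σ (xs ++ ys) ≡ meetingRL σ ys ++ meetingRL σ xs
    meetingRL-++ xs ys =
      trans (cong (filter (_∈? σ)) (reverse-++ xs ys)) (filter-++ (_∈? σ) (reverse ys) (reverse xs))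

    meetingRL-∷ʳ-∈ : ∀ xs {t} → t ∈ σ → meetingRL σ (xs ∷ʳ t) ≡ t ∷ meetingRL σ xs
    meetingRL-∷ʳ-∈ xs t∈σ =
      trans (meetingRL-++ xs [ _ ]) (cong (_++ meetingRL σ xs) (filter-accept (_∈? σ) t∈σ))

    meetingRL-∷ʳ-∉ : ∀ xs {t} → t ∉ σ → meetingRL σ (xs ∷ʳ t) ≡ meetingRL σ xs
    meetingRL-∷ʳ-∉ xs t∉σ =
      trans (meetingRL-++ xs [ _ ]) (cong (_++ meetingRL σ xs) (filter-reject (_∈? σ) t∉σ))

    meetingRL-∷-∈ : ∀ {t} xs → t ∈ σ → meetingRL σ (t ∷ xs) ≡ meetingRL σ xs ∷ʳ t
    meetingRL-∷-∈ xs t∈σ =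
      trans (meetingRL-++ [ _ ] xs) (cong (meetingRL σ xs ++_) (filter-accept (_∈? σ) t∈σ))

    meetingRL-∷-∉ : ∀ {t} xs → t ∉ σ → meetingRL σ (t ∷ xs) ≡ meetingRL σ xs
    meetingRL-∷-∉ xs t∉σ =
      trans (meetingRL-++ [ _ ] xs) (trans (cong (meetingRL σ xs ++_) (filter-reject (_∈? σ) t∉σ)) (++-identityʳ _))

    ∈-meetingRL⁻ : ∀ {xs y} → y ∈ meetingRL σ xs → y ∈ xs × y ∈ σ
    ∈-meetingRL⁻ y∈ = Product.map₁ reverse⁻ (∈-filter⁻ (_∈? σ) y∈)

    ∈-meetingRL⁺ : ∀ {xs y} → y ∈ xs → y ∈ σ → y ∈ meetingRL σ xs
    ∈-meetingRL⁺ y∈xs = ∈-filter⁺ (_∈? σ) (reverse⁺ y∈xs)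

    meetingRL-∷ʳ-split : ∀ xs {ys u} → meetingRL σ xs ≡ ys ∷ʳ u → u ∉ ys →
                         ∃₂ λ U V → xs ≡ U ++ u ∷ V × All (_∉ σ) U × u ∉ V
    meetingRL-∷ʳ-split []       {[]}    () _
    meetingRL-∷ʳ-split []       {_ ∷ _} () _
    meetingRL-∷ʳ-split (x ∷ xs) {ys} meets≡ u∉ys with x ∈? σ
    ... | yes x∈σ with refl , refl ← ∷ʳ-injective _ ys (trans (sym (meetingRL-∷-∈ xs x∈σ)) meets≡) =
      [] , xs , refl , [] , λ x∈xs → u∉ys (∈-meetingRL⁺ x∈xs x∈σ)
    ... | no x∉σ
      with U , V , xs≡ , U∉σ , u∉V ← meetingRL-∷ʳ-split xs (trans (sym (meetingRL-∷-∉ xs x∉σ)) meets≡) u∉ys =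
      x ∷ U , V , cong (x ∷_) xs≡ , x∉σ ∷ U∉σ , u∉V

module Cycles {k : ℕ} (π : Permutation′ (suc k)) where

  Sym : Set
  Sym = Fin (suc k)

  _↦_ : Sym → Sym → Set
  x ↦ y = π ⟨$⟩ʳ x ≡ y

  iter : ℕ → Sym → Sym
  iter zero    y = y
  iter (suc i) y = π ⟨$⟩ʳ iter i y

  π-injective : ∀ {x y} → π ⟨$⟩ʳ x ≡ π ⟨$⟩ʳ y → x ≡ y
  π-injective eq = trans (sym (inverseˡ π)) (trans (cong (π ⟨$⟩ˡ_) eq) (inverseˡ π))

  iter-+ : ∀ i j y → iter (i + j) y ≡ iter i (iter j y)
  iter-+ zero    j y = refl
  iter-+ (suc i) j y = cong (π ⟨$⟩ʳ_) (iter-+ i j y)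

  iter-injective : ∀ i {x y} → iter i x ≡ iter i y → x ≡ y
  iter-injective zero    eq = eq
  iter-injective (suc i) eq = iter-injective i (π-injective eq)

  iter-repeat⇒return : ∀ {x i j} → i < j → iter i x ≡ iter j x → ∃[ e ] (e < j × iter (suc e) x ≡ x)
  iter-repeat⇒return {x} {i} i<j eq with e , refl ← m≤n⇒∃[o]m+o≡n i<j =
    e , m<n+m e (s≤s z≤n) , iter-injective i (begin
      iter i (iter (suc e) x) ≡⟨ iter-+ i (suc e) x ⟨
      iter (i + suc e) x      ≡⟨ cong (λ n → iter n x) (+-suc i e) ⟩
      iter (suc i + e) x      ≡⟨ eq ⟨
      iter i x                ∎)
    where open ≡-Reasoning

  period : ∀ x → ∃[ d ] iter (suc d) x ≡ x
  period x with i , j , i<j , eq ← pigeonhole (n<1+n (suc k)) (λ (i : Fin (suc (suc k))) → iter (toℕ i) x) =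
    Product.map₂ proj₂ (iter-repeat⇒return i<j eq)

  opaque
    least-period : ∀ x → ∃[ d ] (iter (suc d) x ≡ x × ∀ {e} → e < d → iter (suc e) x ≢ x)
    least-period x with D , returns ← period x
      with d , ¬¬returns , below ← ¬∀⟶∃¬-smallest (suc D) (λ i → iter (suc (toℕ i)) x ≢ x)
             (λ i → ¬? (iter (suc (toℕ i)) x ≟ x))
             (λ never → never (fromℕ D) (subst (λ n → iter (suc n) x ≡ x) (sym (toℕ-fromℕ D)) returns)) =
      toℕ d , decidable-stable (iter (suc (toℕ d)) x ≟ x) ¬¬returns ,
      λ e<d → subst (λ n → iter (suc n) x ≢ x) (trans (toℕ-inject (fromℕ< e<d)) (toℕ-fromℕ< e<d))
                    (below (fromℕ< e<d))

  cycleOf : Sym → List Sym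
  cycleOf x = applyUpTo (λ i → iter i x) (suc (proj₁ (least-period x)))

  ∈-cycleOf : ∀ x → x ∈ cycleOf x
  ∈-cycleOf x = here refl

  cycleOf-isCycle : ∀ x → IsCycle π (cycleOf x)
  cycleOf-isCycle x = unique , linked
    where
    d : ℕ
    d = proj₁ (least-period x)

    orbit : ℕ → Sym
    orbit i = iter i x

    unique : Unique (applyUpTo orbit (suc d))
    unique = Unique.applyUpTo⁺₁ orbit (suc d) no-repeat
      where
      no-repeat : ∀ {i j} → i < j → j < suc d → orbit i ≢ orbit j
      no-repeat i<j j<1+d eq with e , e<j , returns ← iter-repeat⇒return i<j eq =
        proj₂ (proj₂ (least-period x)) (<-≤-trans e<j (≤-pred j<1+d)) returns

    linked : Linked _↦_ (applyUpTo orbit (suc d) ++ [ x ])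
    linked = subst (λ y → Linked _↦_ (applyUpTo orbit (suc d) ∷ʳ y)) (proj₁ (proj₂ (least-period x)))
               (subst (Linked _↦_) (sym (applyUpTo-∷ʳ orbit (suc d)))
                  (Linked.applyUpTo⁺₂ orbit (suc (suc d)) λ _ → refl))

  IsCycle⇒Unique : ∀ {σ} → IsCycle π σ → Unique σ
  IsCycle⇒Unique {_ ∷ _} (unique , _) = unique

  Reach : Sym → Sym → Set
  Reach y z = ∃[ i ] iter i y ≡ z

  reach-step : ∀ {x y z} → x ↦ y → Reach y z → Reach x z
  reach-step {x} x↦y (i , refl) = i + 1 , trans (iter-+ i 1 x) (cong (iter i) x↦y)

  Linked-reach-head : ∀ {x xs y} → Linked _↦_ (x ∷ xs) → y ∈ x ∷ xs → Reach x y
  Linked-reach-head _       (here refl)  = 0 , refl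
  Linked-reach-head [-]     (there ())
  Linked-reach-head (r ∷ l) (there y∈xs) = reach-step r (Linked-reach-head l y∈xs)

  Linked-reach-last : ∀ {xs z y} → Linked _↦_ (xs ++ [ z ]) → y ∈ xs → Reach y z
  Linked-reach-last {_ ∷ []}    (r ∷ _) (here refl)  = 1 , r
  Linked-reach-last {_ ∷ _ ∷ _} (r ∷ l) (here refl)  = reach-step r (Linked-reach-last l (here refl))
  Linked-reach-last {_ ∷ _ ∷ _} (_ ∷ l) (there y∈xs) = Linked-reach-last l y∈xs

  Linked-successor∈ : ∀ {xs z y} → Linked _↦_ (xs ++ [ z ]) → y ∈ xs → π ⟨$⟩ʳ y ∈ xs ++ [ z ]
  Linked-successor∈ {_ ∷ []}    (r ∷ _) (here refl)  = there (here r)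
  Linked-successor∈ {_ ∷ _ ∷ _} (r ∷ _) (here refl)  = there (here r)
  Linked-successor∈ {_ ∷ _ ∷ _} (_ ∷ l) (there y∈xs) = there (Linked-successor∈ l y∈xs)

  cycle-closed : ∀ {σ y} → IsCycle π σ → y ∈ σ → π ⟨$⟩ʳ y ∈ σ
  cycle-closed {a ∷ as} (_ , linked) y∈σ with ∈-++⁻ (a ∷ as) (Linked-successor∈ linked y∈σ)
  ... | inj₁ πy∈σ        = πy∈σ
  ... | inj₂ (here πy≡a) = subst (_∈ a ∷ as) (sym πy≡a) (here refl)

  cycle-reach : ∀ {σ y z} → IsCycle π σ → y ∈ σ → z ∈ σ → Reach y z
  cycle-reach {a ∷ as} {y} (_ , linked) y∈σ z∈σ
    with i , refl ← Linked-reach-last linked y∈σ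
    with j , reach ← Linked-reach-head linked (∈-++⁺ˡ z∈σ) = j + i , trans (iter-+ j i y) reach

  cycle-reach-closed : ∀ {σ y z} → IsCycle π σ → y ∈ σ → Reach y z → z ∈ σ
  cycle-reach-closed σ-cycle y∈σ (zero  , refl) = y∈σ
  cycle-reach-closed σ-cycle y∈σ (suc i , refl) = cycle-closed σ-cycle (cycle-reach-closed σ-cycle y∈σ (i , refl))

  cycles-meet⇒⊆ : ∀ {σ σ′ y} → IsCycle π σ → IsCycle π σ′ → y ∈ σ → y ∈ σ′ → σ ⊆ σ′
  cycles-meet⇒⊆ σ-cycle σ′-cycle y∈σ y∈σ′ z∈σ = cycle-reach-closed σ′-cycle y∈σ′ (cycle-reach σ-cycle y∈σ z∈σ)

  cycles : List Sym → List (List Sym)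
  cycles []       = []
  cycles (x ∷ xs) with any? (x ∈?_) (cycles xs)
  ... | yes _ = cycles xs
  ... | no  _ = cycleOf x ∷ cycles xs

  cycles-isCycle : ∀ xs → All (IsCycle π) (cycles xs)
  cycles-isCycle []       = []
  cycles-isCycle (x ∷ xs) with any? (x ∈?_) (cycles xs)
  ... | yes _ = cycles-isCycle xs
  ... | no  _ = cycleOf-isCycle x ∷ cycles-isCycle xs

  cycles-cover : ∀ {x xs} → x ∈ xs → Any (x ∈_) (cycles xs)
  cycles-cover {xs = y ∷ xs} x∈ with any? (y ∈?_) (cycles xs) | x∈
  ... | yes y∈cs | here refl  = y∈cs
  ... | yes _    | there x∈xs = cycles-cover x∈xs
  ... | no  _    | here refl  = here (∈-cycleOf y)
  ... | no  _    | there x∈xs = there (cycles-cover x∈xs)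

  cycles-disjoint : ∀ xs → AllPairs Disjoint (cycles xs)
  cycles-disjoint []       = []
  cycles-disjoint (x ∷ xs) with any? (x ∈?_) (cycles xs)
  ... | yes _    = cycles-disjoint xs
  ... | no  x∉cs = All.tabulate disjoint ∷ cycles-disjoint xs
    where
    disjoint : ∀ {σ} → σ ∈ cycles xs → Disjoint (cycleOf x) σ
    disjoint σ∈ (y∈ , y∈σ) =
      x∉cs (lose σ∈ (cycles-meet⇒⊆ (cycleOf-isCycle x) (All.lookup (cycles-isCycle xs) σ∈) y∈ y∈σ (∈-cycleOf x)))

  cycles-distinct : ∀ xs → AllPairs (λ σ σ′ → ¬ SameCycle σ σ′) (cycles xs)
  cycles-distinct []       = []
  cycles-distinct (x ∷ xs) with any? (x ∈?_) (cycles xs)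
  ... | yes _    = cycles-distinct xs
  ... | no  x∉cs = All.tabulate (λ σ∈ (⊆σ , _) → x∉cs (lose σ∈ (⊆σ (∈-cycleOf x)))) ∷ cycles-distinct xs

module Factorisation {k : ℕ} (π : Permutation′ (suc k)) (f : List (Fin (suc k)))
                     (star-list : IsStarList f) (c1 : C1 π f) (c2 : C2 π f) where

  open Cycles π

  Pos : Set
  Pos = Fin (length f)

  τ : Pos → Sym
  τ = lookup f

  τ≢zero : ∀ i → τ i ≢ F.zero
  τ≢zero i = All.lookup star-list (∈-lookup i)

  distinct-positions : ∀ {σ a b} → τ a ∈ σ → τ b ∉ σ → toℕ a ≢ toℕ b
  distinct-positions {σ} τa∈σ τb∉σ a≡b = τb∉σ (subst (λ x → τ x ∈ σ) (toℕ-injective a≡b) τa∈σ)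

  prod-take-suc : ∀ j y → prod (take (suc (toℕ j)) f) y ≡ prod (take (toℕ j) f) (star (τ j) y)
  prod-take-suc j y = trans (cong (λ xs → prod xs y) (take-suc f j)) (prod-++ (take (toℕ j) f) [ τ j ] y)

  meetingRL-take-skip : ∀ σ {s} q → s ≤ q → q ≤ length f → (∀ i → s ≤ toℕ i → toℕ i < q → τ i ∉ σ) →
                        meetingRL σ (take q f) ≡ meetingRL σ (take s f)
  meetingRL-take-skip σ zero    z≤n _ _ = refl
  meetingRL-take-skip σ {s} (suc q) s≤1+q q<len avoid with m≤n⇒m<n∨m≡n s≤1+q
  ... | inj₂ refl  = refl
  ... | inj₁ s<1+q = begin
    meetingRL σ (take (suc q) f)  ≡⟨ cong (meetingRL σ) (take-suc′ f q<len) ⟩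
    meetingRL σ (take q f ∷ʳ τ i) ≡⟨ meetingRL-∷ʳ-∉ σ (take q f) (avoid i s≤i (s≤s (≤-reflexive i≡q))) ⟩
    meetingRL σ (take q f)        ≡⟨ meetingRL-take-skip σ q (≤-pred s<1+q) (<⇒≤ q<len)
                                       (λ i′ s≤i′ i′<q → avoid i′ s≤i′ (<-trans i′<q (n<1+n q))) ⟩
    meetingRL σ (take s f)        ∎
    where
    open ≡-Reasoning
    i : Pos
    i = fromℕ< q<len
    i≡q : toℕ i ≡ q
    i≡q = toℕ-fromℕ< q<len
    s≤i : s ≤ toℕ i
    s≤i = subst (s ≤_) (sym i≡q) (≤-pred s<1+q)

  meetingRL-take⇒position : ∀ {σ q} → meetingRL σ (take q f) ≢ [] → ∃[ i ] (toℕ i < q × τ i ∈ σ)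
  meetingRL-take⇒position {σ} {q} nonempty with meetingRL σ (take q f) in meets≡
  ... | []    = contradiction refl nonempty
  ... | y ∷ _ with y∈take , y∈σ ← ∈-meetingRL⁻ σ (subst (y ∈_) (sym meets≡) (here refl))
              with i , i<q , refl ← ∈-take⇒lookup f q y∈take = i , i<q , y∈σ

  FirstMeeting : List Sym → List Sym → Set
  FirstMeeting σ xs = prod xs F.zero ≡ fromMaybe F.zero (head (meetingRL σ xs))

  StartsAt : List Sym → ℕ → Set
  StartsAt σ p = (p ≡ length f × F.zero ∈ σ) ⊎ ∃[ i ] (toℕ i ≡ p × τ i ∈ σ)

  Pending : List Sym → List Sym → Set
  Pending σ xs = F.zero ∈ σ ⊎ meetingRL σ xs ≢ []

  Nested : List Sym → Pos → Pos → Set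
  Nested σ a b = F.zero ∉ σ × (∀ i → τ i ∈ σ → a F.< i × i F.< b)

  pending⇒¬nested : ∀ {σ a b} → Pending σ (take (suc (toℕ a)) f) → ¬ Nested σ a b
  pending⇒¬nested (inj₁ 0∈σ)      (0∉σ , _)    = 0∉σ 0∈σ
  pending⇒¬nested (inj₂ nonempty) (_ , inside) with i , i≤a , τi∈σ ← meetingRL-take⇒position nonempty =
    <⇒≱ (proj₁ (inside i τi∈σ)) (≤-pred i≤a)

  -- The walk of 1 through the prefix `take q f` of f, started at p: the factor at position p meets σ,
  -- or p is the end of f and 1 ∈ σ. Invariant: the factors at positions [q, p) avoid σ and form whole
  -- cycles (`Block q`), and σ still contains 1 or meets a factor left of q (`Pending`).
  module Walk {σ : List Sym} (σ-cycle : IsCycle π σ) {p : ℕ} (start : StartsAt σ p) where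

    p≤length : p ≤ length f
    p≤length =
      [ (λ (p≡ , _) → ≤-reflexive p≡) , (λ (i , i≡p , _) → subst (_≤ length f) i≡p (<⇒≤ (toℕ<n i))) ]′ start

    start⇒¬nested : ∀ {a b} → toℕ b ≤ p → ¬ Nested σ a b
    start⇒¬nested {b = b} b≤p (0∉σ , inside) =
      [ (λ (_ , 0∈σ) → 0∉σ 0∈σ)
      , (λ (i , i≡p , τi∈σ) → <⇒≱ (proj₂ (inside i τi∈σ)) (subst (toℕ b ≤_) (sym i≡p) b≤p))
      ]′ start

    Confined : ℕ → Pos → Set
    Confined q i = ∀ {σ′} → IsCycle π σ′ → τ i ∈ σ′ → ∀ i′ → τ i′ ∈ σ′ → q ≤ toℕ i′ × toℕ i′ < p

    confined-weaken : ∀ {q q′ i} → q′ ≤ q → Confined q i → Confined q′ i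
    confined-weaken q′≤q confined σ′-cycle τi∈σ′ i′ τi′∈σ′ =
      Product.map₁ (≤-trans q′≤q) (confined σ′-cycle τi∈σ′ i′ τi′∈σ′)

    Block : ℕ → Set
    Block q = ∀ i → q ≤ toℕ i → toℕ i < p → τ i ∉ σ × Confined q i

    WalkFrom : ℕ → Set
    WalkFrom q = q ≤ p → Block q → Pending σ (take q f) → Unique (meetingRL σ (take q f)) →
                 FirstMeeting σ (take q f)

    Skip : Pos → ℕ → Set
    Skip j s = s < suc (toℕ j) × Block s
             × prod (take (suc (toℕ j)) f) F.zero ≡ prod (take s f) F.zero
             × meetingRL σ (take (suc (toℕ j)) f) ≡ meetingRL σ (take s f)

    walk-meets : ∀ j → τ j ∈ σ → Unique (meetingRL σ (take (suc (toℕ j)) f)) →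
                 FirstMeeting σ (take (suc (toℕ j)) f)
    walk-meets j τj∈σ unique = begin
      prod (take (suc (toℕ j)) f) F.zero                            ≡⟨ prod-take-suc j F.zero ⟩
      prod (take (toℕ j) f) (τ j)                                   ≡⟨ prod-fix (τ≢zero j) τj∉prefix ⟩
      τ j                                                           ≡⟨ cong (fromMaybe F.zero ∘ head) meets≡ ⟨
      fromMaybe F.zero (head (meetingRL σ (take (suc (toℕ j)) f)))  ∎
      where
      open ≡-Reasoning
      meets≡ : meetingRL σ (take (suc (toℕ j)) f) ≡ τ j ∷ meetingRL σ (take (toℕ j) f)
      meets≡ = trans (cong (meetingRL σ) (take-suc f j)) (meetingRL-∷ʳ-∈ σ (take (toℕ j) f) τj∈σ)
      τj∉prefix : τ j ∉ take (toℕ j) f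
      τj∉prefix τj∈ = Unique.Unique[x∷xs]⇒x∉xs (subst Unique meets≡ unique) (∈-meetingRL⁺ σ τj∈ τj∈σ)

    -- By (C2) its cycle σ̂ avoids 1 and lies left of the start, so τ j is the
    -- rightmost factor meeting σ̂, and by (C1) τ j = a₁ occurs once more, at the leftmost such factor.
    module Detour (j : Pos) (j<p : toℕ j < p) (block : Block (suc (toℕ j)))
                  (pending : Pending σ (take (suc (toℕ j)) f)) (τj∉σ : τ j ∉ σ) where

      σ̂ : List Sym
      σ̂ = cycleOf (τ j)

      σ̂-cycle : IsCycle π σ̂
      σ̂-cycle = cycleOf-isCycle (τ j)

      τj∈σ̂ : τ j ∈ σ̂
      τj∈σ̂ = ∈-cycleOf (τ j)

      ∈σ̂⇒∉σ : ∀ {y} → y ∈ σ̂ → y ∉ σ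
      ∈σ̂⇒∉σ y∈σ̂ y∈σ = τj∉σ (cycles-meet⇒⊆ σ̂-cycle σ-cycle y∈σ̂ y∈σ τj∈σ̂)

      σ̂≠σ : ¬ SameCycle σ̂ σ
      σ̂≠σ (σ̂⊆σ , _) = τj∉σ (σ̂⊆σ τj∈σ̂)

      σ≠σ̂ : ¬ SameCycle σ σ̂
      σ≠σ̂ (_ , σ̂⊆σ) = τj∉σ (σ̂⊆σ τj∈σ̂)

      σ̂-before-start : ∀ i → τ i ∈ σ̂ → toℕ i < p
      σ̂-before-start i τi∈σ̂ with toℕ i <? p
      ... | yes i<p = i<p
      ... | no  i≮p = beyond start
        where
        beyond : StartsAt σ p → toℕ i < p
        beyond (inj₁ (p≡ , _))         = contradiction (subst (toℕ i <_) (sym p≡) (toℕ<n i)) i≮p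
        beyond (inj₂ (a , a≡p , τa∈σ)) =
          contradiction (c2 σ̂ σ σ̂-cycle σ-cycle σ̂≠σ j a i j<a a<i τj∈σ̂ τi∈σ̂ τa∈σ) (pending⇒¬nested pending)
          where
          j<a : toℕ j < toℕ a
          j<a = subst (toℕ j <_) (sym a≡p) j<p
          a<i : toℕ a < toℕ i
          a<i = ≤∧≢⇒< (subst (_≤ toℕ i) (sym a≡p) (≮⇒≥ i≮p)) (distinct-positions τa∈σ (∈σ̂⇒∉σ τi∈σ̂))

      σ̂-ends-at-j : ∀ i → τ i ∈ σ̂ → toℕ i ≤ toℕ j
      σ̂-ends-at-j i τi∈σ̂ with toℕ i ≤? toℕ j
      ... | yes i≤j = i≤j
      ... | no  i≰j = contradiction
        (proj₁ (proj₂ (block i (≰⇒> i≰j) (σ̂-before-start i τi∈σ̂)) σ̂-cycle τi∈σ̂ j τj∈σ̂)) (<-irrefl refl)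

      σ̂-avoids-zero : F.zero ∉ σ̂
      σ̂-avoids-zero 0∈σ̂ = surrounded pending start
        where
        surrounded : Pending σ (take (suc (toℕ j)) f) → StartsAt σ p → ⊥
        surrounded (inj₁ 0∈σ)      _                = ∈σ̂⇒∉σ 0∈σ̂ 0∈σ
        surrounded (inj₂ _)        (inj₁ (_ , 0∈σ)) = ∈σ̂⇒∉σ 0∈σ̂ 0∈σ
        surrounded (inj₂ nonempty) (inj₂ (a , a≡p , τa∈σ))
          with m , m<1+j , τm∈σ ← meetingRL-take⇒position nonempty =
          proj₁ (c2 σ σ̂ σ-cycle σ̂-cycle σ≠σ̂ m j a m<j (subst (toℕ j <_) (sym a≡p) j<p) τm∈σ τa∈σ τj∈σ̂) 0∈σ̂
          where
          m<j : toℕ m < toℕ j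
          m<j = ≤∧≢⇒< (≤-pred m<1+j) (distinct-positions τm∈σ τj∉σ)

      σ̂-factors : meetingRL σ̂ f ≡ τ j ∷ meetingRL σ̂ (take (toℕ j) f)
      σ̂-factors = begin
        meetingRL σ̂ f                        ≡⟨ cong (meetingRL σ̂) (take-all (length f) f ≤-refl) ⟨
        meetingRL σ̂ (take (length f) f)      ≡⟨ meetingRL-take-skip σ̂ (length f) (toℕ<n j) ≤-refl after-j ⟩
        meetingRL σ̂ (take (suc (toℕ j)) f)   ≡⟨ cong (meetingRL σ̂) (take-suc f j) ⟩
        meetingRL σ̂ (take (toℕ j) f ∷ʳ τ j)  ≡⟨ meetingRL-∷ʳ-∈ σ̂ (take (toℕ j) f) τj∈σ̂ ⟩
        τ j ∷ meetingRL σ̂ (take (toℕ j) f)   ∎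
        where
        open ≡-Reasoning
        after-j : ∀ i → suc (toℕ j) ≤ toℕ i → toℕ i < length f → τ i ∉ σ̂
        after-j i j<i _ τi∈σ̂ = <⇒≱ j<i (σ̂-ends-at-j i τi∈σ̂)

      opening : ∃₂ λ U V → take (toℕ j) f ≡ U ++ τ j ∷ V × All (_∉ σ̂) U × τ j ∉ V
      opening with proj₁ (c1 σ̂ σ̂-cycle) σ̂-avoids-zero
      ... | a₁ , as , (unique , _) , _ , _ , _ , meets≡
          with refl , prefix≡ ← ∷-injective (trans (sym σ̂-factors) meets≡) =
        meetingRL-∷ʳ-split σ̂ (take (toℕ j) f) prefix≡ (Unique.Unique[x∷xs]⇒x∉xs unique)

      module Opening (o : Pos) (o<j : toℕ o < toℕ j) (τo∈σ̂ : τ o ∈ σ̂)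
                     (before-o : ∀ i → toℕ i < toℕ o → τ i ∉ σ̂) where

        within-σ̂ : ∀ i → τ i ∈ σ̂ → toℕ o ≤ toℕ i × toℕ i < p
        within-σ̂ i τi∈σ̂ = ≮⇒≥ (λ i<o → before-o i i<o τi∈σ̂) , ≤-<-trans (σ̂-ends-at-j i τi∈σ̂) j<p

        inside : ∀ i → toℕ o < toℕ i → toℕ i < toℕ j → τ i ∉ σ̂ →
                 ∀ {σ′} → IsCycle π σ′ → τ i ∈ σ′ → Nested σ′ o j
        inside i o<i i<j τi∉σ̂ σ′-cycle τi∈σ′ =
          c2 σ̂ _ σ̂-cycle σ′-cycle (λ (_ , σ′⊆σ̂) → τi∉σ̂ (σ′⊆σ̂ τi∈σ′)) o i j o<i i<j τo∈σ̂ τj∈σ̂ τi∈σ′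

        block-o : Block (toℕ o)
        block-o i o≤i i<p with suc (toℕ j) ≤? toℕ i | τ i ∈? σ̂
        ... | yes j<i | _ = Product.map₂ (confined-weaken (≤-trans (<⇒≤ o<j) (n≤1+n _))) (block i j<i i<p)
        ... | no _ | yes τi∈σ̂ =
          ∈σ̂⇒∉σ τi∈σ̂ ,
          λ σ′-cycle τi∈σ′ i′ τi′∈σ′ → within-σ̂ i′ (cycles-meet⇒⊆ σ′-cycle σ̂-cycle τi∈σ′ τi∈σ̂ τi′∈σ′)
        ... | no j≮i | no τi∉σ̂ =
          (λ τi∈σ → start⇒¬nested (<⇒≤ j<p) (inside i o<i i<j τi∉σ̂ σ-cycle τi∈σ)) ,
          λ σ′-cycle τi∈σ′ i′ τi′∈σ′ →
            Product.map <⇒≤ (λ i′<j → <-trans i′<j j<p) (proj₂ (inside i o<i i<j τi∉σ̂ σ′-cycle τi∈σ′) i′ τi′∈σ′)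
          where
          o<i : toℕ o < toℕ i
          o<i = ≤∧≢⇒< o≤i (distinct-positions τo∈σ̂ τi∉σ̂)
          i<j : toℕ i < toℕ j
          i<j = ≤∧≢⇒< (≤-pred (≰⇒> j≮i)) (distinct-positions τj∈σ̂ τi∉σ̂ ∘ sym)

        meetingRL≡ : meetingRL σ (take (suc (toℕ j)) f) ≡ meetingRL σ (take (toℕ o) f)
        meetingRL≡ = meetingRL-take-skip σ (suc (toℕ j)) (≤-trans (<⇒≤ o<j) (n≤1+n _)) (toℕ<n j)
                       (λ i o≤i i<1+j → proj₁ (block-o i o≤i (<-≤-trans i<1+j j<p)))

      detour : ∃ (Skip j)
      detour with U , V , split , U∉σ̂ , τj∉V ← opening
             with o , o≡ , o<j , τo≡τj ← lookup-take-split f (toℕ j) U V split =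
        toℕ o , <-trans o<j (n<1+n _) , block-o , prod≡ , meetingRL≡
        where
        take-o : take (toℕ o) f ≡ U
        take-o = trans (cong (λ n → take n f) o≡) (take-length-prefix f (toℕ j) U split)

        before-o : ∀ i → toℕ i < toℕ o → τ i ∉ σ̂
        before-o i i<o = All.lookup U∉σ̂ (subst (τ i ∈_) take-o (lookup∈take f i i<o))

        open Opening o o<j (subst (_∈ σ̂) (sym τo≡τj) τj∈σ̂) before-o

        prod≡ : prod (take (suc (toℕ j)) f) F.zero ≡ prod (take (toℕ o) f) F.zero
        prod≡ = begin
          prod (take (suc (toℕ j)) f) F.zero ≡⟨ prod-take-suc j F.zero ⟩
          prod (take (toℕ j) f) (τ j)        ≡⟨ cong (λ xs → prod xs (τ j)) split ⟩
          prod (U ++ τ j ∷ V) (τ j)          ≡⟨ prod-last-occurrence U V (τ≢zero j) τj∉V ⟩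
          prod U F.zero                      ≡⟨ cong (λ xs → prod xs F.zero) take-o ⟨
          prod (take (toℕ o) f) F.zero       ∎
          where open ≡-Reasoning

    walk-at : ∀ j → (∀ {s} → s < suc (toℕ j) → WalkFrom s) → WalkFrom (suc (toℕ j))
    walk-at j rec j<p block pending unique with τ j ∈? σ
    ... | yes τj∈σ = walk-meets j τj∈σ unique
    ... | no  τj∉σ = resume (Detour.detour j j<p block pending τj∉σ)
      where
      open ≡-Reasoning
      resume : ∃ (Skip j) → FirstMeeting σ (take (suc (toℕ j)) f)
      resume (s , s<1+j , block-s , prod≡ , meets≡) = begin
        prod (take (suc (toℕ j)) f) F.zero                            ≡⟨ prod≡ ⟩
        prod (take s f) F.zero                                        ≡⟨ rec s<1+j (≤-trans (≤-pred s<1+j) (<⇒≤ j<p))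
                                                                           block-s (Sum.map₂ (_∘ trans meets≡) pending)
                                                                           (subst Unique meets≡ unique) ⟩
        fromMaybe F.zero (head (meetingRL σ (take s f)))              ≡⟨ cong (fromMaybe F.zero ∘ head) meets≡ ⟨
        fromMaybe F.zero (head (meetingRL σ (take (suc (toℕ j)) f)))  ∎

    walk : ∀ q → WalkFrom q
    walk = <-rec WalkFrom step
      where
      step : ∀ q → (∀ {s} → s < q → WalkFrom s) → WalkFrom q
      step zero    _   _   _ _ _ = refl
      step (suc q) rec q<p = subst WalkFrom j≡q (walk-at (fromℕ< q<len) λ {s} → rec ∘ subst (s <_) j≡q) q<p
        where
        q<len : q < length f
        q<len = ≤-trans q<p p≤length
        j≡q : suc (toℕ (fromℕ< q<len)) ≡ suc q
        j≡q = cong suc (toℕ-fromℕ< q<len)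

    walk-start : Pending σ (take p f) → Unique (meetingRL σ (take p f)) → FirstMeeting σ (take p f)
    walk-start = walk p ≤-refl (λ i p≤i i<p → contradiction i<p (≤⇒≯ p≤i))

  walk-prefix : ∀ {σ} P {R} → IsCycle π σ → f ≡ P ++ R → StartsAt σ (length P) →
                Pending σ P → Unique (meetingRL σ P) → FirstMeeting σ P
  walk-prefix {σ} P σ-cycle f≡ start =
    subst (λ xs → Pending σ xs → Unique (meetingRL σ xs) → FirstMeeting σ xs)
          (take-length-prefix f (length f) P (trans (take-all (length f) f ≤-refl) f≡))
          (Walk.walk-start σ-cycle start)

  meetingRL-successor : ∀ {σ} → IsCycle π σ → ∀ X {x} Y → meetingRL σ f ≡ X ++ x ∷ Y → x ∉ X →
                        π ⟨$⟩ʳ x ≡ fromMaybe F.zero (head Y) × Unique Y × (F.zero ∈ σ ⊎ Y ≢ [])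
  meetingRL-successor {σ} σ-cycle X {x} Y meets≡ x∉X with F.zero ∈? σ
  ... | yes 0∈σ with proj₂ (c1 σ σ-cycle) 0∈σ
  ...   | bs , (_ ∷ bs-unique , linked) , _ , _ , bs≡ =
    Linked-next (F.zero ∷ X) Y (subst (λ L → Linked _↦_ (F.zero ∷ L)) bs++0≡ linked) ,
    Unique-suffix X (subst Unique bs≡X bs-unique) , inj₁ 0∈σ
    where
    bs≡X : bs ≡ X ++ x ∷ Y
    bs≡X = trans (sym bs≡) meets≡
    bs++0≡ : bs ++ [ F.zero ] ≡ X ++ x ∷ Y ++ [ F.zero ]
    bs++0≡ = trans (cong (_++ [ F.zero ]) bs≡X) (++-assoc X (x ∷ Y) [ F.zero ])
  meetingRL-successor σ-cycle X Y meets≡ x∉X | no 0∉σ with proj₁ (c1 _ σ-cycle) 0∉σ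
  ...   | _ , _ , (unique , linked) , _ , _ , _ , a₁≡ =
    Product.map₂ (Product.map₂ inj₂) (Linked-cycle-next unique linked X Y (trans (sym a₁≡) meets≡) x∉X)

  ∈-factors : ∀ {y} → y ≢ F.zero → y ∈ f
  ∈-factors {y} y≢0 = proj₁ (∈-meetingRL⁻ σ (meets (F.zero ∈? σ)))
    where
    σ : List Sym
    σ = cycleOf y
    meets : Dec (F.zero ∈ σ) → y ∈ meetingRL σ f
    meets (yes 0∈σ) with proj₂ (c1 σ (cycleOf-isCycle y)) 0∈σ
    ... | _ , _ , (_ , σ⊆) , _ , bs≡ with σ⊆ (∈-cycleOf y)
    ...   | here y≡0   = contradiction y≡0 y≢0
    ...   | there y∈bs = subst (y ∈_) (sym bs≡) y∈bs
    meets (no 0∉σ) with proj₁ (c1 σ (cycleOf-isCycle y)) 0∉σ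
    ... | _ , _ , _ , (_ , σ⊆) , _ , _ , meets≡ = subst (y ∈_) (sym meets≡) (∈-++⁺ˡ (σ⊆ (∈-cycleOf y)))

  prod-zero : prod f F.zero ≡ π ⟨$⟩ʳ F.zero
  prod-zero with proj₂ (c1 (cycleOf F.zero) (cycleOf-isCycle F.zero)) (∈-cycleOf F.zero)
  ... | bs , (_ ∷ bs-unique , linked) , _ , _ , bs≡ = begin
    prod f F.zero                            ≡⟨ walk-prefix f σ-cycle (sym (++-identityʳ f)) (inj₁ (refl , 0∈σ))
                                                  (inj₁ 0∈σ) (subst Unique (sym bs≡) bs-unique) ⟩
    fromMaybe F.zero (head (meetingRL σ f))  ≡⟨ cong (fromMaybe F.zero ∘ head) bs≡ ⟩
    fromMaybe F.zero (head bs)               ≡⟨ Linked-next [] bs linked ⟨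
    π ⟨$⟩ʳ F.zero                            ∎
    where
    open ≡-Reasoning
    σ : List Sym
    σ = cycleOf F.zero
    σ-cycle : IsCycle π σ
    σ-cycle = cycleOf-isCycle F.zero
    0∈σ : F.zero ∈ σ
    0∈σ = ∈-cycleOf F.zero

  prod-last-factor : ∀ {x} P S → x ≢ F.zero → f ≡ P ++ x ∷ S → x ∉ S → prod f x ≡ π ⟨$⟩ʳ x
  prod-last-factor {x} P S x≢0 f≡ x∉S =
    conclude (meetingRL-successor σ-cycle (meetingRL σ S) (meetingRL σ P) meets≡ (x∉S ∘ proj₁ ∘ ∈-meetingRL⁻ σ))
    where
    open ≡-Reasoning
    σ : List Sym
    σ = cycleOf x
    σ-cycle : IsCycle π σ
    σ-cycle = cycleOf-isCycle x

    meets≡ : meetingRL σ f ≡ meetingRL σ S ++ x ∷ meetingRL σ P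
    meets≡ = begin
      meetingRL σ f                          ≡⟨ cong (meetingRL σ) f≡ ⟩
      meetingRL σ (P ++ x ∷ S)               ≡⟨ meetingRL-++ σ P (x ∷ S) ⟩
      meetingRL σ (x ∷ S) ++ meetingRL σ P   ≡⟨ cong (_++ meetingRL σ P) (meetingRL-∷-∈ σ S (∈-cycleOf x)) ⟩
      (meetingRL σ S ∷ʳ x) ++ meetingRL σ P  ≡⟨ ++-assoc (meetingRL σ S) [ x ] (meetingRL σ P) ⟩
      meetingRL σ S ++ x ∷ meetingRL σ P     ∎

    start : StartsAt σ (length P)
    start with i , i≡ , _ , τi≡x ← lookup-take-split f (length f) P S (trans (take-all (length f) f ≤-refl) f≡) =
      inj₂ (i , i≡ , subst (_∈ σ) (sym τi≡x) (∈-cycleOf x))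

    conclude : π ⟨$⟩ʳ x ≡ fromMaybe F.zero (head (meetingRL σ P)) × Unique (meetingRL σ P) × Pending σ P →
               prod f x ≡ π ⟨$⟩ʳ x
    conclude (successor , unique , pending) = begin
      prod f x                                 ≡⟨ cong (λ xs → prod xs x) f≡ ⟩
      prod (P ++ x ∷ S) x                      ≡⟨ prod-last-occurrence P S x≢0 x∉S ⟩
      prod P F.zero                            ≡⟨ walk-prefix P σ-cycle f≡ start pending unique ⟩
      fromMaybe F.zero (head (meetingRL σ P))  ≡⟨ successor ⟨
      π ⟨$⟩ʳ x                                 ∎

  prod≗π : ∀ x → prod f x ≡ π ⟨$⟩ʳ x
  prod≗π x with x ≟ F.zero
  ... | yes refl = prod-zero
  ... | no  x≢0 with P , S , f≡ , x∉S ← ∈-∃++-last _≟_ (∈-factors x≢0) = prod-last-factor P S x≢0 f≡ x∉S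

  factors-to-zero : ∀ x → ∃[ ws ] (ws ⊆ f × prod ws x ≡ F.zero)
  factors-to-zero x with x ≟ F.zero
  ... | yes x≡0 = [] , (λ ()) , x≡0
  ... | no  x≢0 = [ x ] , (λ { (here refl) → ∈-factors x≢0 }) , star-self x

  factors-from-zero : ∀ y → ∃[ ws ] (ws ⊆ f × prod ws F.zero ≡ y)
  factors-from-zero y with y ≟ F.zero
  ... | yes y≡0 = [] , (λ ()) , sym y≡0
  ... | no  y≢0 = [ y ] , (λ { (here refl) → ∈-factors y≢0 }) , refl

  isTransitive : IsTransitive f
  isTransitive x y with ws₁ , ws₁⊆f , x↦0 ← factors-to-zero x | ws₂ , ws₂⊆f , 0↦y ← factors-from-zero y =
    ws₂ ++ ws₁ , [ ws₂⊆f , ws₁⊆f ]′ ∘ ∈-++⁻ ws₂ , trans (prod-++ ws₂ ws₁ x) (trans (cong (prod ws₂) x↦0) 0↦y)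

  countIn : List Sym → List Sym → ℕ
  countIn σ xs = length (filter (_∈? σ) xs)

  countIn-++ : ∀ σ xs ys → countIn σ (xs ++ ys) ≡ countIn σ xs + countIn σ ys
  countIn-++ σ xs ys = trans (cong length (filter-++ (_∈? σ) xs ys)) (length-++ (filter (_∈? σ) xs))

  countIn-allFin : ∀ {σ} → Unique σ → countIn σ (allFin (suc k)) ≡ length σ
  countIn-allFin {σ} σ-unique =
    unique∧⊆∧⊇⇒length≡ (Unique.filter⁺ (_∈? σ) (Unique.allFin⁺ (suc k))) σ-unique
      (proj₂ ∘ ∈-filter⁻ (_∈? σ)) (∈-filter⁺ (_∈? σ) (∈-allFin _))

  SameCycle⇒length≡ : ∀ {σ σ′} → IsCycle π σ → IsCycle π σ′ → SameCycle σ σ′ → length σ ≡ length σ′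
  SameCycle⇒length≡ σ-cycle σ′-cycle (σ⊆σ′ , σ′⊆σ) =
    unique∧⊆∧⊇⇒length≡ (IsCycle⇒Unique σ-cycle) (IsCycle⇒Unique σ′-cycle) σ⊆σ′ σ′⊆σ

  -- The two appended copies of 1 raise the ℓ − 1 factors of the cycle of 1 to ℓ + 1, as for every other cycle.
  cycle-factor-count : ∀ {σ} → IsCycle π σ → countIn σ (reverse f ++ F.zero ∷ F.zero ∷ []) ≡ suc (length σ)
  cycle-factor-count {σ} σ-cycle with F.zero ∈? σ
  ... | yes 0∈σ with proj₂ (c1 σ σ-cycle) 0∈σ
  ...   | bs , bs-cycle , same , _ , bs≡ = begin
    countIn σ (reverse f ++ F.zero ∷ F.zero ∷ [])             ≡⟨ countIn-++ σ (reverse f) _ ⟩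
    length (meetingRL σ f) + countIn σ (F.zero ∷ F.zero ∷ []) ≡⟨ cong₂ _+_ (cong length bs≡)
                                                                   (cong length (filter-all (_∈? σ) (0∈σ ∷ 0∈σ ∷ []))) ⟩
    length bs + 2                                             ≡⟨ +-comm (length bs) 2 ⟩
    suc (length (F.zero ∷ bs))                                ≡⟨ cong suc (SameCycle⇒length≡ bs-cycle σ-cycle same) ⟩
    suc (length σ)                                            ∎
    where open ≡-Reasoning
  cycle-factor-count {σ} σ-cycle | no 0∉σ with proj₁ (c1 σ σ-cycle) 0∉σ
  ...   | a₁ , as , a₁-cycle , same , _ , _ , a₁≡ = begin
    countIn σ (reverse f ++ F.zero ∷ F.zero ∷ [])             ≡⟨ countIn-++ σ (reverse f) _ ⟩
    length (meetingRL σ f) + countIn σ (F.zero ∷ F.zero ∷ []) ≡⟨ cong₂ _+_ (cong length a₁≡)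
                                                                   (cong length (filter-none (_∈? σ) (0∉σ ∷ 0∉σ ∷ []))) ⟩
    length ((a₁ ∷ as) ++ [ a₁ ]) + 0                          ≡⟨ +-identityʳ _ ⟩
    length ((a₁ ∷ as) ++ [ a₁ ])                              ≡⟨ length-++ (a₁ ∷ as) ⟩
    length (a₁ ∷ as) + 1                                      ≡⟨ +-comm (length (a₁ ∷ as)) 1 ⟩
    suc (length (a₁ ∷ as))                                    ≡⟨ cong suc (SameCycle⇒length≡ a₁-cycle σ-cycle same) ⟩
    suc (length σ)                                            ∎
    where open ≡-Reasoning

  cs : List (List Sym)
  cs = cycles (allFin (suc k))

  in-exactly-one-cycle : ∀ x → length (filter (x ∈?_) cs) ≡ 1
  in-exactly-one-cycle x =
    length-filter≡1 (x ∈?_) (AllPairs.map (λ disjoint → disjoint {x}) (cycles-disjoint (allFin (suc k))))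
      (cycles-cover (∈-allFin x))

  numCycles : NumCycles π (length cs)
  numCycles = cs , cycles-isCycle (allFin (suc k)) , cycles-distinct (allFin (suc k)) ,
              (λ x → find (cycles-cover (∈-allFin x))) , refl

  length-factors : length f + 2 ≡ suc k + length cs
  length-factors = begin
    length f + 2                                                       ≡⟨ cong (_+ 2) (length-reverse f) ⟨
    length (reverse f) + 2                                             ≡⟨ length-++ (reverse f) ⟨
    length (reverse f ++ F.zero ∷ F.zero ∷ [])                         ≡⟨ cs-count (reverse f ++ F.zero ∷ F.zero ∷ []) ⟨
    sum (map (λ σ → countIn σ (reverse f ++ F.zero ∷ F.zero ∷ [])) cs) ≡⟨ cong sum (map-cong-local
                                                                            (All.map cycle-factor-count cs-cycles)) ⟩
    sum (map (λ σ → suc (length σ)) cs)                                ≡⟨ sum-map-suc length cs ⟩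
    sum (map length cs) + length cs                                    ≡⟨ cong (_+ length cs) cs-partition ⟩
    suc k + length cs                                                  ∎
    where
    open ≡-Reasoning
    cs-cycles : All (IsCycle π) cs
    cs-cycles = cycles-isCycle (allFin (suc k))

    cs-count : ∀ xs → sum (map (λ σ → countIn σ xs) cs) ≡ length xs
    cs-count xs = double-counting _∈?_ xs cs (λ _ → in-exactly-one-cycle _)

    cs-partition : sum (map length cs) ≡ suc k
    cs-partition = begin
      sum (map length cs)                              ≡⟨ cong sum (map-cong-local
                                                            (All.map (countIn-allFin ∘ IsCycle⇒Unique) cs-cycles)) ⟨
      sum (map (λ σ → countIn σ (allFin (suc k))) cs)  ≡⟨ cs-count (allFin (suc k)) ⟩
      length (allFin (suc k))                          ≡⟨ length-tabulate (λ x → x) ⟩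
      suc k                                            ∎

lemma2p3 : ∀ (k : ℕ) (π : Permutation′ (suc k)) (f : List (Fin (suc k))) →
    IsStarList f → C1 π f → C2 π f →
    (∀ x → prod f x ≡ π ⟨$⟩ʳ x) × IsMinTransStarFact π f
lemma2p3 k π f star-list c1 c2 =
  prod≗π , star-list , prod≗π , isTransitive , length cs , numCycles , length-factors
  where open Factorisation π f star-list c1 c2
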